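{- Let $\mathcal I$ be a saturated small step alternating pushdown system. If a configuration $A$ has a proof in $\mathcal I$, then $A$ has a cut-free proof in $\mathcal I$.
   Context: Fix a language with finitely many unary predicate symbols (states), finitely many unary function symbols (stack symbols), a constant $\varepsilon$ and a variable $x$. Words are closed terms $\gamma_1(\cdots\gamma_n(\varepsilon))$, written $\gamma_1\cdots\gamma_n$; configurations are atomic propositions $P(w)$ with $P$ a state and $w$ a word. A proof of a configuration $A$ in a set of rules is a finite tree with root labeled $A$, each node labeled by a configuration and annotated by a rule $\frac{A_1\cdots A_n}{B}$ of the system together with a substitution $\sigma$ of a word for $x$ such that the node is labeled $\sigma B$ and its children $\sigma A_1,\dots,\sigma A_n$. Premises of a rule are regarded as a finite set. Rule types: an introduction rule is $\frac{P_1(x)\cdots P_n(x)}{Q(\gamma x)}$ ($\gamma$ a stack symbol, $n\ge0$) or $\frac{}{Q(\varepsilon)}$; an elimination rule is $\frac{P_1(\gamma x)\ P_2(x)\cdots P_n(x)}{Q(x)}$ ($n\ge1$); a neutral rule is $\frac{P_1(x)\cdots P_n(x)}{Q(x)}$ ($n\ge0$). A small step alternating pushdown system is a finite set of introduction, elimination and neutral rules. It is saturated if it is closed under: (1) if it contains an introduction rule $\frac{P_1(x)\cdots P_m(x)}{Q_1(\gamma x)}$ and an elimination rule $\frac{Q_1(\gamma x)\ Q_2(x)\cdots Q_n(x)}{R(x)}$, it contains the neutral rule $\frac{P_1(x)\cdots P_m(x)\ Q_2(x)\cdots Q_n(x)}{R(x)}$; (2) if for a stack symbol $\gamma$ it contains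 introduction rules $\frac{P^i_1(x)\cdots P^i_{m_i}(x)}{Q_i(\gamma x)}$ ($i=1,\dots,n$) and a neutral rule $\frac{Q_1(x)\cdots Q_n(x)}{R(x)}$ ($n\ge0$), it contains $\frac{P^1_1(x)\cdots P^n_{m_n}(x)}{R(\gamma x)}$ (all these premises together; for $n=0$, $\frac{}{R(\gamma x)}$ for every $\gamma$); (3) if it contains introduction rules $\frac{}{Q_i(\varepsilon)}$ ($i=1,\dots,n$) and a neutral rule $\frac{Q_1(x)\cdots Q_n(x)}{R(x)}$ ($n\ge0$), it contains $\frac{}{R(\varepsilon)}$. A cut is a (sub)proof of one of the following forms: (a) its root $R(w)$ is obtained by an elimination rule whose premise $Q_1(\gamma w)$ is obtained by an introduction rule; (b) its root $R(\gamma w)$ is obtained by a neutral rule all of whose premises $Q_1(\gamma w),\dots,Q_n(\gamma w)$ are obtained by introduction rules; (c) its root $R(\varepsilon)$ is obtained by a neutral rule all of whose premises $Q_1(\varepsilon),\dots,Q_n(\varepsilon)$ are obtained by introduction rules $\frac{}{Q_i(\varepsilon)}$. A proof is cut-free if none of its subproofs is a cut. -}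

module Defs where

open import Data.Nat using (ℕ)
open import Data.Fin using (Fin)
open import Data.Fin.Subset as Sub using (Subset; _∪_)
open import Data.Bool using (Bool; _∧_)
open import Data.Vec using (tabulate; lookup)
open import Data.List using (List; []; _∷_; allFin)
open import Data.Bool.ListAction using (any)
open import Data.List.Membership.Propositional using (_∈_)
open import Data.Product using (_×_; _,_; Σ)
open import Data.Empty using (⊥)
open import Data.Unit using (⊤)
open import Relation.Nullary using (¬_)

-- nS = number of states (unary predicate symbols), nΓ = number of stack symbols.
-- Words γ₁(⋯γₙ(ε)) are lists [γ₁,…,γₙ]; the head is the outermost symbol.
Word : ℕ → Set
Word nΓ = List (Fin nΓ)

Config : ℕ → ℕ → Set
Config nS nΓ = Fin nS × Word nΓ

data Rule (nS nΓ : ℕ) : Set where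
  -- P₁(x) ⋯ Pₙ(x) / Q(γ x)        : intro γ Q {P₁,…,Pₙ}
  intro   : Fin nΓ → Fin nS → Subset nS → Rule nS nΓ
  --  / Q(ε)                       : introε Q
  introε  : Fin nS → Rule nS nΓ
  -- P₁(γ x) P₂(x) ⋯ Pₙ(x) / Q(x)  : elim γ P₁ {P₂,…,Pₙ} Q
  elim    : Fin nΓ → Fin nS → Subset nS → Fin nS → Rule nS nΓ
  -- P₁(x) ⋯ Pₙ(x) / Q(x)          : neutral {P₁,…,Pₙ} Q
  neutral : Subset nS → Fin nS → Rule nS nΓ

System : ℕ → ℕ → Set
System nS nΓ = List (Rule nS nΓ)

-- ⋃_{Q ∈ T} f Q
unionOver : ∀ {n} → Subset n → (Fin n → Subset n) → Subset n
unionOver {n} T f = tabulate (λ P → any (λ Q → lookup T Q ∧ lookup (f Q) P) (allFin n))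

record Saturated {nS nΓ : ℕ} (I : System nS nΓ) : Set where
  field
    sat-elim : ∀ γ Q₁ S T R → intro γ Q₁ S ∈ I → elim γ Q₁ T R ∈ I →
               neutral (S ∪ T) R ∈ I
    -- (2)  (for each premise Q of the neutral rule, a chosen introduction rule
    --       with conclusion Q(γ x) and premise set f Q)
    sat-intro : ∀ γ T R (f : Fin nS → Subset nS) → neutral T R ∈ I →
                (∀ Q → Q Sub.∈ T → intro γ Q (f Q) ∈ I) →
                intro γ R (unionOver T f) ∈ I
    sat-ε : ∀ T R → neutral T R ∈ I → (∀ Q → Q Sub.∈ T → introε Q ∈ I) →
            introε R ∈ I

data Proof {nS nΓ : ℕ} (I : System nS nΓ) : Config nS nΓ → Set where
  byIntro   : ∀ {γ Q S w} → intro γ Q S ∈ I →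
              (∀ P → P Sub.∈ S → Proof I (P , w)) → Proof I (Q , γ ∷ w)
  byIntroε  : ∀ {Q} → introε Q ∈ I → Proof I (Q , [])
  byElim    : ∀ {γ P₁ S Q w} → elim γ P₁ S Q ∈ I →
              Proof I (P₁ , γ ∷ w) → (∀ P → P Sub.∈ S → Proof I (P , w)) →
              Proof I (Q , w)
  byNeutral : ∀ {S Q w} → neutral S Q ∈ I →
              (∀ P → P Sub.∈ S → Proof I (P , w)) → Proof I (Q , w)

module _ {nS nΓ : ℕ} {I : System nS nΓ} where

  ByIntro : ∀ {c} → Proof I c → Set
  ByIntro (byIntro _ _)   = ⊤
  ByIntro (byIntroε _)    = ⊤
  ByIntro (byElim _ _ _)  = ⊥
  ByIntro (byNeutral _ _) = ⊥

  -- the proof (at its root) is a cut: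
  -- (a) elimination whose premise Q₁(γ w) is obtained by an introduction rule;
  -- (b)/(c) neutral rule all of whose premises are obtained by introduction
  --   rules (at R(γ w) these are rules for γ, at R(ε) these are rules /Q(ε),
  --   since that is the only way to conclude such configurations).
  IsCut : ∀ {c} → Proof I c → Set
  IsCut (byIntro _ _)      = ⊥
  IsCut (byIntroε _)       = ⊥
  IsCut (byElim _ p _)     = ByIntro p
  IsCut (byNeutral _ ps)   = ∀ P (h : P Sub.∈ _) → ByIntro (ps P h)

  CutFree : ∀ {c} → Proof I c → Set
  CutFree p@(byIntro _ ps)    = ¬ IsCut p × (∀ P h → CutFree (ps P h))
  CutFree p@(byIntroε _)      = ¬ IsCut p
  CutFree p@(byElim _ q ps)   = ¬ IsCut p × CutFree q × (∀ P h → CutFree (ps P h))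
  CutFree p@(byNeutral _ ps)  = ¬ IsCut p × (∀ P h → CutFree (ps P h))

module Submission where

-- A proof is normalised bottom-up, by structural recursion on the proof:
-- the immediate subproofs are normalised first, and then the root rule is
-- re-applied to the cut-free premises by a "smart constructor" that never
-- creates a cut.
--   * Introduction rules never form a cut, so they are re-applied as they are.
--   * A neutral rule forms a cut only when all its premises end with
--     introduction rules; saturation (2) (for R(γ w)) or (3) (for R(ε)) then
--     replaces the whole cut by a single introduction rule whose premises are
--     the (already cut-free) premises of those introductions.
--   * An elimination rule forms a cut only when its major premise ends with an
--     introduction; saturation (1) turns the pair into a neutral rule, which
--     is handled by the neutral constructor.

open import Defs
open import Data.Nat using (ℕ)
open import Data.Product using (Σ; ∃; _,_; _×_; proj₁; proj₂)
open import Data.Fin using (Fin; zero; suc)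
open import Data.Fin.Subset as Sub using (Subset; _∪_; inside; outside)
open import Data.Fin.Subset.Properties using (_∈?_; x∈p∪q⁻)
open import Data.Bool as Bool using (_∧_)
open import Data.Bool.ListAction using (any)
open import Data.Bool.Properties using (T-∧; T-≡)
open import Data.Vec as Vec using (lookup; here; there)
open import Data.Vec.Properties using (lookup∘tabulate; []=⇒lookup; lookup⇒[]=)
open import Data.List using ([]; _∷_; allFin)
open import Data.List.Membership.Propositional using (_∈_)
open import Data.List.Relation.Unary.Any using (satisfied)
open import Data.List.Relation.Unary.Any.Properties using (any⁻)
open import Data.Sum using (inj₁; inj₂)
open import Data.Empty using (⊥-elim)
open import Data.Unit using (tt)
open import Function.Bundles using (Equivalence)
open import Relation.Nullary using (Dec; yes; no)
open import Relation.Binary.PropositionalEquality using (trans; sym)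

all∈? : ∀ {n} (T : Subset n) {B : ∀ P → P Sub.∈ T → Set} →
        (∀ P h → Dec (B P h)) → Dec (∀ P h → B P h)
all∈? Vec.[] _ = yes (λ _ ())
all∈? (outside Vec.∷ T) d with all∈? T (λ P h → d (suc P) (there h))
... | yes b = yes λ { (suc P) (there h) → b P h }
... | no ¬b = no (λ b → ¬b (λ P h → b (suc P) (there h)))
all∈? (inside Vec.∷ T) d with d zero here | all∈? T (λ P h → d (suc P) (there h))
... | no ¬b₀ | _     = no (λ b → ¬b₀ (b zero here))
... | yes _  | no ¬b = no (λ b → ¬b (λ P h → b (suc P) (there h)))
... | yes b₀ | yes b = yes λ { zero here → b₀ ; (suc P) (there h) → b P h }

-- Choice over a subset: witnesses given for each member assemble into one
-- total function (arbitrary value `a` outside the subset).  Saturation (2)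
-- needs the premise sets of the chosen introduction rules as such a function.
choose∈ : ∀ {n} {A : Set} (T : Subset n) {B : Fin n → A → Set} → A →
          (∀ Q → Q Sub.∈ T → Σ A (B Q)) →
          Σ (Fin n → A) (λ f → ∀ Q → Q Sub.∈ T → B Q (f Q))
choose∈ {A = A} T {B} a g = (λ Q → pick Q (Q ∈? T)) , (λ Q → picked Q (Q ∈? T))
  where
  pick : ∀ Q → Dec (Q Sub.∈ T) → A
  pick Q (yes h) = proj₁ (g Q h)
  pick Q (no _)  = a
  picked : ∀ Q (d : Dec (Q Sub.∈ T)) → Q Sub.∈ T → B Q (pick Q d)
  picked Q (yes h) _ = proj₂ (g Q h)
  picked Q (no ∉T) h = ⊥-elim (∉T h)

∈-unionOver⁻ : ∀ {n} (T : Subset n) (f : Fin n → Subset n) P →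
               P Sub.∈ unionOver T f → ∃ λ Q → Q Sub.∈ T × P Sub.∈ f Q
∈-unionOver⁻ {n} T f P h with satisfied (any⁻ _ (allFin n) anyHolds)
  where
  anyHolds : Bool.T (any (λ Q → lookup T Q ∧ lookup (f Q) P) (allFin n))
  anyHolds = Equivalence.from T-≡ (trans (sym (lookup∘tabulate _ P)) ([]=⇒lookup h))
... | Q , both with Equivalence.to T-∧ both
... | Q∈T , P∈fQ =
  Q , lookup⇒[]= Q T (Equivalence.to T-≡ Q∈T) , lookup⇒[]= P (f Q) (Equivalence.to T-≡ P∈fQ)

module CutElimination {nS nΓ : ℕ} (I : System nS nΓ) (sat : Saturated I) where
  open Saturated sat

  CutFreeProof : Config nS nΓ → Set
  CutFreeProof c = Σ (Proof I c) CutFree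

  CutFreePremises : Subset nS → Word nΓ → Set
  CutFreePremises S w = ∀ P → P Sub.∈ S → CutFreeProof (P , w)

  byIntro? : ∀ {c} (p : Proof I c) → Dec (ByIntro p)
  byIntro? (byIntro _ _)   = yes tt
  byIntro? (byIntroε _)    = yes tt
  byIntro? (byElim _ _ _)  = no (λ ())
  byIntro? (byNeutral _ _) = no (λ ())

  introInversion : ∀ {γ Q w} (p : Proof I (Q , γ ∷ w)) → CutFree p → ByIntro p →
                   Σ (Subset nS) (λ S → intro γ Q S ∈ I × CutFreePremises S w)
  introInversion (byIntro {S = S} r ps) (_ , cfs) _ = S , r , λ P h → ps P h , cfs P h

  introεInversion : ∀ {Q} (p : Proof I (Q , [])) → ByIntro p → introε Q ∈ I
  introεInversion (byIntroε r) _ = r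

  introCF : ∀ {γ Q S w} → intro γ Q S ∈ I → CutFreePremises S w → CutFreeProof (Q , γ ∷ w)
  introCF r ks = byIntro r (λ P h → proj₁ (ks P h)) , (λ ()) , λ P h → proj₂ (ks P h)

  -- Case (b): a neutral rule on premises Q(γ w) that all end in introductions
  -- collapses, by saturation (2), into one introduction rule for R(γ w).
  neutralIntroCF : ∀ {T R γ w} → neutral T R ∈ I → (ks : CutFreePremises T (γ ∷ w)) →
                   (∀ Q h → ByIntro (proj₁ (ks Q h))) → CutFreeProof (R , γ ∷ w)
  neutralIntroCF {T} {R} {γ} {w} r ks allIntro with choose∈ T Sub.⊥ inverted
    where
    inverted : ∀ Q → Q Sub.∈ T → Σ (Subset nS) (λ S → intro γ Q S ∈ I × CutFreePremises S w)
    inverted Q h = introInversion (proj₁ (ks Q h)) (proj₂ (ks Q h)) (allIntro Q h)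
  ... | f , spec = introCF (sat-intro γ T R f r (λ Q h → proj₁ (spec Q h))) premises
    where
    premises : CutFreePremises (unionOver T f) w
    premises P h with ∈-unionOver⁻ T f P h
    ... | Q , Q∈T , P∈fQ = proj₂ (spec Q Q∈T) P P∈fQ

  -- A neutral rule applied to cut-free premises yields a cut-free proof:
  -- either it is no cut, or it is a cut of kind (b) or (c) removed by saturation.
  neutralCF : ∀ {T R w} → neutral T R ∈ I → CutFreePremises T w → CutFreeProof (R , w)
  neutralCF {T} r ks with all∈? T (λ Q h → byIntro? (proj₁ (ks Q h)))
  ... | no notCut =
    byNeutral r (λ P h → proj₁ (ks P h)) , notCut , λ P h → proj₂ (ks P h)
  neutralCF {T} {R} {[]} r ks | yes allIntro =
    byIntroε (sat-ε T R r (λ Q h → introεInversion (proj₁ (ks Q h)) (allIntro Q h))) , λ ()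
  neutralCF {w = _ ∷ _} r ks | yes allIntro = neutralIntroCF r ks allIntro

  -- An elimination rule applied to cut-free premises yields a cut-free proof;
  -- a cut of kind (a) becomes, by saturation (1), a neutral rule on the
  -- premises of the introduction together with the minor premises.
  elimCF : ∀ {γ P₁ T R w} → elim γ P₁ T R ∈ I → CutFreeProof (P₁ , γ ∷ w) →
           CutFreePremises T w → CutFreeProof (R , w)
  elimCF {γ} {P₁} {T} {R} r (byIntro {S = S} r' ps , _ , cfs) ks =
    neutralCF (sat-elim γ P₁ S T R r' r) premises
    where
    premises : CutFreePremises (S ∪ T) _
    premises P h with x∈p∪q⁻ S T h
    ... | inj₁ P∈S = ps P P∈S , cfs P P∈S
    ... | inj₂ P∈T = ks P P∈T
  elimCF r (p@(byElim _ _ _) , cf) ks =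
    byElim r p (λ P h → proj₁ (ks P h)) , (λ ()) , cf , λ P h → proj₂ (ks P h)
  elimCF r (p@(byNeutral _ _) , cf) ks =
    byElim r p (λ P h → proj₁ (ks P h)) , (λ ()) , cf , λ P h → proj₂ (ks P h)

  normalise : ∀ {c} → Proof I c → CutFreeProof c
  normalise (byIntro r ps)   = introCF r (λ P h → normalise (ps P h))
  normalise (byIntroε r)     = byIntroε r , λ ()
  normalise (byElim r p ps)  = elimCF r (normalise p) (λ P h → normalise (ps P h))
  normalise (byNeutral r ps) = neutralCF r (λ P h → normalise (ps P h))

lemma4 : ∀ {nS nΓ : ℕ} (I : System nS nΓ) → Saturated I →
         ∀ {A : Config nS nΓ} → Proof I A → Σ (Proof I A) CutFree
lemma4 I sat = CutElimination.normalise I sat
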